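{- Let $L$ be a lattice in the variety $\mathcal{N}$ generated by $N_5$, and assume that $L$ has no doubly reducible elements. Then there do not exist twelve distinct elements $c, x', x, b, z, z', w', w, a, s, y, y' \in L$ such that (i) the order that $L$ induces on these twelve elements is exactly the partial order generated by the relations $x' < x < b < z < z'$, $w' < w < a < s < y < y'$, $w' < x'$, $w < x$, $a < c < b$, $y < z$, and $y' < z'$ (so that all pairs not comparable under these generated relations are incomparable in $L$), and (ii) the sublattice of $L$ generated by $\{x', x, b, z, z', w', w, a, y, y'\}$ is isomorphic to $\mathbf{2} \times \mathbf{5}$.
   Context: $N_5$ is the five-element lattice $\{0, x, y, z, 1\}$ with $0 < y < z < 1$, $0 < x < 1$, $x$ incomparable to $y$ and $z$; $\mathcal{N}$ is the lattice variety it generates. An element $u$ of a lattice is doubly reducible if there exist $u_1,u_2,u_3,u_4$ with $u_1, u_2$ incomparable, $u_3,u_4$ incomparable, and $u = u_1 \vee u_2 = u_3 \wedge u_4$. $\mathbf{n}$ denotes the $n$-element chain and $\mathbf{2}\times\mathbf{5}$ the direct product (componentwise order). -}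

module Defs where

open import Level using (Level; _⊔_)
open import Data.Nat using (ℕ)
open import Data.Fin using (Fin)
import Data.Fin as F
open import Data.Product using (Σ; ∃; _×_; _,_; proj₁; proj₂)
open import Relation.Nullary using (¬_)
open import Relation.Binary.PropositionalEquality using (_≡_)
open import Relation.Binary.Construct.Closure.ReflexiveTransitive using (Star)
open import Relation.Binary.Lattice.Bundles using (Lattice)
open import Function.Bundles using (_⇔_)

-- The lattice N₅ = {0, x, y, z, 1} with 0 < y < z < 1, 0 < x < 1,
-- x incomparable to y and z.

data N5 : Set where
  n0 nx ny nz n1 : N5

_∨ₙ_ : N5 → N5 → N5
n0 ∨ₙ v  = v
n1 ∨ₙ v  = n1
nx ∨ₙ n0 = nx
nx ∨ₙ nx = nx
nx ∨ₙ ny = n1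
nx ∨ₙ nz = n1
nx ∨ₙ n1 = n1
ny ∨ₙ n0 = ny
ny ∨ₙ nx = n1
ny ∨ₙ ny = ny
ny ∨ₙ nz = nz
ny ∨ₙ n1 = n1
nz ∨ₙ n0 = nz
nz ∨ₙ nx = n1
nz ∨ₙ ny = nz
nz ∨ₙ nz = nz
nz ∨ₙ n1 = n1

_∧ₙ_ : N5 → N5 → N5
n0 ∧ₙ v  = n0
n1 ∧ₙ v  = v
nx ∧ₙ n0 = n0
nx ∧ₙ nx = nx
nx ∧ₙ ny = n0
nx ∧ₙ nz = n0
nx ∧ₙ n1 = nx
ny ∧ₙ n0 = n0
ny ∧ₙ nx = n0
ny ∧ₙ ny = ny
ny ∧ₙ nz = ny
ny ∧ₙ n1 = ny
nz ∧ₙ n0 = n0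
nz ∧ₙ nx = n0
nz ∧ₙ ny = ny
nz ∧ₙ nz = nz
nz ∧ₙ n1 = nz

data Term : Set where
  var  : ℕ → Term
  _∨ᵗ_ : Term → Term → Term
  _∧ᵗ_ : Term → Term → Term

evalN5 : (ℕ → N5) → Term → N5
evalN5 ρ (var i)  = ρ i
evalN5 ρ (s ∨ᵗ t) = evalN5 ρ s ∨ₙ evalN5 ρ t
evalN5 ρ (s ∧ᵗ t) = evalN5 ρ s ∧ₙ evalN5 ρ t

module _ {c ℓ₁ ℓ₂ : Level} (L : Lattice c ℓ₁ ℓ₂) where
  open Lattice L

  eval : (ℕ → Carrier) → Term → Carrier
  eval ρ (var i)  = ρ i
  eval ρ (s ∨ᵗ t) = eval ρ s ∨ eval ρ t
  eval ρ (s ∧ᵗ t) = eval ρ s ∧ eval ρ t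

  InVarietyN : Set (c ⊔ ℓ₁)
  InVarietyN = (s t : Term) → ((ρ : ℕ → N5) → evalN5 ρ s ≡ evalN5 ρ t) →
               (ρ : ℕ → Carrier) → eval ρ s ≈ eval ρ t

  Incomparable : Carrier → Carrier → Set ℓ₂
  Incomparable u v = ¬ (u ≤ v) × ¬ (v ≤ u)

  DoublyReducible : Carrier → Set (c ⊔ ℓ₁ ⊔ ℓ₂)
  DoublyReducible u = Σ Carrier λ u₁ → Σ Carrier λ u₂ → Σ Carrier λ u₃ → Σ Carrier λ u₄ →
    Incomparable u₁ u₂ × Incomparable u₃ u₄ × u ≈ u₁ ∨ u₂ × u ≈ u₃ ∧ u₄

  NoDoublyReducible : Set (c ⊔ ℓ₁ ⊔ ℓ₂)
  NoDoublyReducible = (u : Carrier) → ¬ DoublyReducible u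

  data GenSub {p : Level} (P : Carrier → Set p) : Carrier → Set (c ⊔ ℓ₁ ⊔ p) where
    gen  : ∀ {u} → P u → GenSub P u
    join : ∀ {u v} → GenSub P u → GenSub P v → GenSub P (u ∨ v)
    meet : ∀ {u v} → GenSub P u → GenSub P v → GenSub P (u ∧ v)
    resp : ∀ {u v} → u ≈ v → GenSub P u → GenSub P v

_≤₂₅_ : Fin 2 × Fin 5 → Fin 2 × Fin 5 → Set
(i , j) ≤₂₅ (k , l) = (i F.≤ k) × (j F.≤ l)

module _ {c ℓ₁ ℓ₂ : Level} (L : Lattice c ℓ₁ ℓ₂) where
  open Lattice L

  IsoTo2×5 : {p : Level} → (Carrier → Set p) → Set (c ⊔ ℓ₁ ⊔ ℓ₂ ⊔ p)
  IsoTo2×5 S = Σ (Fin 2 × Fin 5 → Carrier) λ f →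
      ((q : Fin 2 × Fin 5) → S (f q))
    × ((u : Carrier) → S u → ∃ λ q → u ≈ f q)
    × ((q r : Fin 2 × Fin 5) → (f q ≤ f r) ⇔ (q ≤₂₅ r))

data Lbl : Set where
  c x' x b z z' w' w a s y y' : Lbl

data Cov : Lbl → Lbl → Set where
  x'x  : Cov x' x
  xb   : Cov x b
  bz   : Cov b z
  zz'  : Cov z z'
  w'w  : Cov w' w
  wa   : Cov w a
  as   : Cov a s
  sy   : Cov s y
  yy'  : Cov y y'
  w'x' : Cov w' x'
  wx   : Cov w x
  ac   : Cov a c
  cb   : Cov c b
  yz   : Cov y z
  y'z' : Cov y' z'

_⊑_ : Lbl → Lbl → Set
_⊑_ = Star Cov

data InTen : Lbl → Set where
  t-x' : InTen x'
  t-x  : InTen x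
  t-b  : InTen b
  t-z  : InTen z
  t-z' : InTen z'
  t-w' : InTen w'
  t-w  : InTen w
  t-a  : InTen a
  t-y  : InTen y
  t-y' : InTen y'

module _ {c ℓ₁ ℓ₂ : Level} (L : Lattice c ℓ₁ ℓ₂) where
  open Lattice L

  Configuration : Set (c ⊔ ℓ₁ ⊔ ℓ₂)
  Configuration = Σ (Lbl → Carrier) λ e →
      ((i j : Lbl) → ¬ (i ≡ j) → ¬ (e i ≈ e j))
    × ((i j : Lbl) → (e i ≤ e j) ⇔ (i ⊑ j))
    × IsoTo2×5 L (GenSub L (λ u → Σ Lbl λ i → InTen i × u ≈ e i))

module Submission where

-- The ten generators are pairwise distinct (e reflects the order) and generate a
-- sublattice with only ten elements, so they are that sublattice; since they sit in
-- it like the cells of 2 × 5, their meets and joins are computed cellwise, giving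
-- x ∧ a = w, x' ∧ y' = w', y' ∧ z = y and x' ∨ y = z.  With m = x' ∧ c, identities
-- of N₅ then give w ∨ m = (x' ∨ w) ∧ (a ∨ m), which forces m ≤ w as w ∨ m is not
-- doubly reducible, and next c ∨ y = (x' ∨ y) ∧ (c ∨ y'), a doubly reducible element.

open import Defs
open import Relation.Nullary using (¬_)
open import Relation.Binary.Lattice.Bundles using (Lattice)

open import Level using (_⊔_)
open import Data.Fin using (Fin; toℕ; punchOut)
open import Data.Fin.Patterns using (0F; 1F; 2F; 3F; 4F)
import Data.Fin.Properties as Finₚ
open import Data.Nat as ℕ using (ℕ; suc)
import Data.Nat.Properties as ℕₚ
open import Data.Product using (∃; Σ; _×_; _,_; proj₁; proj₂)
open import Function using (_∘_; _↔_; _⇔_; mk↔ₛ′; Inverse; Injection; Equivalence)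
open import Function.Definitions using (Injective)
open import Function.Properties.Inverse using (↔⇒↣; ↔-sym)
open import Relation.Binary.Bundles using (Setoid)
open import Relation.Binary.Construct.Closure.ReflexiveTransitive using (ε; _◅_)
open import Relation.Binary.Definitions using (DecidableEquality; Reflexive; Transitive; Antisymmetric)
import Relation.Binary.Definitions as B
open import Relation.Binary.PropositionalEquality as ≡ using (_≡_)
open import Relation.Nullary using (Dec; yes; no; contradiction)
open import Relation.Nullary.Decidable using (map′; via-injection; _×-dec_; toWitness; False; toWitnessFalse)
open import Relation.Unary using (Pred; Decidable)
import Relation.Binary.Lattice.Properties.JoinSemilattice as JoinSemilatticeₚ
import Relation.Binary.Lattice.Properties.MeetSemilattice as MeetSemilatticeₚ
import Relation.Binary.Reasoning.PartialOrder as ≤-Reasoning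

Fin-injective⇒surjective : ∀ {n} {h : Fin n → Fin n} → Injective _≡_ _≡_ h →
                           ∀ j → ∃ λ i → h i ≡ j
Fin-injective⇒surjective {suc n} {h} h-injective j with Finₚ.any? (λ i → h i Finₚ.≟ j)
... | yes hit = hit
... | no miss = contradiction (Finₚ.injective⇒≤ h∖j-injective) ℕₚ.1+n≰n
  where
  j≢h : ∀ i → ¬ j ≡ h i
  j≢h i eq = miss (i , ≡.sym eq)
  h∖j : Fin (suc n) → Fin n
  h∖j i = punchOut (j≢h i)
  h∖j-injective : Injective _≡_ _≡_ h∖j
  h∖j-injective eq = h-injective (Finₚ.punchOut-injective (j≢h _) (j≢h _) eq)

module Finite {ℓ} {A : Set ℓ} {n} (enum : A ↔ Fin n) where
  open Inverse enum
  open Injection (↔⇒↣ enum) using () renaming (injective to to-injective)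
  open Injection (↔⇒↣ (↔-sym enum)) using () renaming (injective to from-injective)

  _≟_ : DecidableEquality A
  _≟_ = via-injection (↔⇒↣ enum) Finₚ._≟_

  all? : ∀ {p} {P : Pred A p} → Decidable P → Dec (∀ v → P v)
  all? {P = P} P? = map′ (λ ∀P v → ≡.subst P (strictlyInverseʳ v) (∀P (to v)))
                         (λ ∀P i → ∀P (from i))
                         (Finₚ.all? (P? ∘ from))

  injective⇒surjective : {h : A → A} → Injective _≡_ _≡_ h → ∀ t → ∃ λ v → h v ≡ t
  injective⇒surjective {h} h-injective t
    with i , eq ← Fin-injective⇒surjective {h = to ∘ h ∘ from}
                    (from-injective ∘ h-injective ∘ to-injective) (to t)
    = from i , to-injective eq

module _ {ℓ₀ ℓ} (S : Setoid ℓ₀ ℓ) where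
  open Setoid S

  injection-into-image-is-onto :
    ∀ {q n} {Q : Set q} → Q ↔ Fin n → (f g : Q → Carrier) →
    (∀ {i j} → g i ≈ g j → i ≡ j) → (∀ i → ∃ λ j → g i ≈ f j) →
    ∀ j → ∃ λ i → f j ≈ g i
  injection-into-image-is-onto {Q = Q} enum f g g-injective g⊆f j =
    let i , hi≡j = Finite.injective⇒surjective enum h-injective j in
    i , trans (reflexive (≡.cong f (≡.sym hi≡j))) (sym (proj₂ (g⊆f i)))
    where
    h : Q → Q
    h i = proj₁ (g⊆f i)
    h-injective : Injective _≡_ _≡_ h
    h-injective {i} {i′} eq =
      g-injective (trans (proj₂ (g⊆f i))
                         (trans (reflexive (≡.cong f eq)) (sym (proj₂ (g⊆f i′)))))

N5↔Fin5 : N5 ↔ Fin 5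
N5↔Fin5 = mk↔ₛ′ index label index-label label-index
  where
  index : N5 → Fin 5
  index n0 = 0F
  index nx = 1F
  index ny = 2F
  index nz = 3F
  index n1 = 4F
  label : Fin 5 → N5
  label 0F = n0
  label 1F = nx
  label 2F = ny
  label 3F = nz
  label 4F = n1
  index-label : ∀ i → index (label i) ≡ i
  index-label 0F = ≡.refl
  index-label 1F = ≡.refl
  index-label 2F = ≡.refl
  index-label 3F = ≡.refl
  index-label 4F = ≡.refl
  label-index : ∀ v → label (index v) ≡ v
  label-index n0 = ≡.refl
  label-index nx = ≡.refl
  label-index ny = ≡.refl
  label-index nz = ≡.refl
  label-index n1 = ≡.refl

assignment : ∀ {ℓ} {A : Set ℓ} → A → A → A → A → ℕ → A
assignment p q r u 0 = p
assignment p q r u 1 = q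
assignment p q r u 2 = r
assignment p q r u (suc (suc (suc _))) = u

HoldsInN5 : Term → Term → Set
HoldsInN5 lhs rhs = ∀ p q r u → evalN5 (assignment p q r u) lhs ≡ evalN5 (assignment p q r u) rhs

holdsInN5? : ∀ lhs rhs → Dec (HoldsInN5 lhs rhs)
holdsInN5? lhs rhs = all? λ p → all? λ q → all? λ r → all? λ u →
  evalN5 (assignment p q r u) lhs ≟ evalN5 (assignment p q r u) rhs
  where open Finite N5↔Fin5

v₀ v₁ v₂ v₃ : Term
v₀ = var 0
v₁ = var 1
v₂ = var 2
v₃ = var 3

module LawsOf𝒩 {ℓ₀ ℓ₁ ℓ₂} (L : Lattice ℓ₀ ℓ₁ ℓ₂) (inV : InVarietyN L) where
  open Lattice L
  open JoinSemilatticeₚ joinSemilattice using (∨-monotonic)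
  open MeetSemilatticeₚ meetSemilattice using (∧-monotonic)
  open ≤-Reasoning poset

  -- The terms mention only the variables 0–3, so evalN5 ρ agrees definitionally
  -- with evalN5 (assignment (ρ 0) (ρ 1) (ρ 2) (ρ 3)) on them.
  identity₁ : ∀ p q r → p ∧ (q ∨ r) ≈ (p ∧ (q ∨ (p ∧ r))) ∨ (p ∧ (r ∨ (p ∧ q)))
  identity₁ p q r =
    inV lhs rhs (λ ρ → toWitness {a? = holdsInN5? lhs rhs} _ (ρ 0) (ρ 1) (ρ 2) (ρ 3))
        (assignment p q r r)
    where
    lhs rhs : Term
    lhs = v₀ ∧ᵗ (v₁ ∨ᵗ v₂)
    rhs = (v₀ ∧ᵗ (v₁ ∨ᵗ (v₀ ∧ᵗ v₂))) ∨ᵗ (v₀ ∧ᵗ (v₂ ∨ᵗ (v₀ ∧ᵗ v₁)))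

  -- Under the hypotheses of ∨≈∧-law₁ (resp. ∨≈∧-law₂) below, q′ and u′ (resp. q′
  -- and r′) equal q and u (resp. q and r); building them into the terms is what lets
  -- a conditional law of N₅ be checked as an identity.
  identity₂ : ∀ p q r u → let q′ = (p ∨ (q ∧ r)) ∧ r ; u′ = u ∨ r in
              (p ∨ q′) ∧ (r ∨ (p ∧ u′)) ≈ q′ ∨ (p ∧ u′)
  identity₂ p q r u =
    inV lhs rhs (λ ρ → toWitness {a? = holdsInN5? lhs rhs} _ (ρ 0) (ρ 1) (ρ 2) (ρ 3))
        (assignment p q r u)
    where
    q′ u′ lhs rhs : Term
    q′ = (v₀ ∨ᵗ (v₁ ∧ᵗ v₂)) ∧ᵗ v₂
    u′ = v₃ ∨ᵗ v₂
    lhs = (v₀ ∨ᵗ q′) ∧ᵗ (v₂ ∨ᵗ (v₀ ∧ᵗ u′))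
    rhs = q′ ∨ᵗ (v₀ ∧ᵗ u′)

  identity₃ : ∀ p q r u → let q′ = u ∧ (p ∨ (q ∧ u)) ; r′ = r ∧ (p ∨ q′) in
              (p ∨ q′) ∧ (r′ ∨ u) ≈ (r′ ∨ q′) ∨ (p ∧ (r′ ∨ u))
  identity₃ p q r u =
    inV lhs rhs (λ ρ → toWitness {a? = holdsInN5? lhs rhs} _ (ρ 0) (ρ 1) (ρ 2) (ρ 3))
        (assignment p q r u)
    where
    q′ r′ lhs rhs : Term
    q′ = v₃ ∧ᵗ (v₀ ∨ᵗ (v₁ ∧ᵗ v₃))
    r′ = v₂ ∧ᵗ (v₀ ∨ᵗ q′)
    lhs = (v₀ ∨ᵗ q′) ∧ᵗ (r′ ∨ᵗ v₃)
    rhs = (r′ ∨ᵗ q′) ∨ᵗ (v₀ ∧ᵗ (r′ ∨ᵗ v₃))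

  ∧-distribˡ-∨-absorbed : ∀ {p q r} → p ∧ r ≤ q → p ∧ q ≤ r →
                          p ∧ (q ∨ r) ≤ (p ∧ q) ∨ (p ∧ r)
  ∧-distribˡ-∨-absorbed {p} {q} {r} p∧r≤q p∧q≤r = begin
    p ∧ (q ∨ r)                                ≈⟨ identity₁ p q r ⟩
    (p ∧ (q ∨ (p ∧ r))) ∨ (p ∧ (r ∨ (p ∧ q)))  ≤⟨ ∨-monotonic (∧-monotonic refl (∨-least refl p∧r≤q))
                                                             (∧-monotonic refl (∨-least refl p∧q≤r)) ⟩
    (p ∧ q) ∨ (p ∧ r)                          ∎

  ∨≈∧-law₁ : ∀ {p q r u} → q ≤ r → r ≤ u → (p ∨ q) ∧ r ≤ q →
             q ∨ (p ∧ u) ≈ (p ∨ q) ∧ (r ∨ (p ∧ u))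
  ∨≈∧-law₁ {p} {q} {r} {u} q≤r r≤u [p∨q]∧r≤q = antisym
    (∨-least (∧-greatest (y≤x∨y p q) (trans q≤r (x≤x∨y r _)))
             (∧-greatest (trans (x∧y≤x p u) (x≤x∨y p q)) (y≤x∨y r _)))
    (begin
      (p ∨ q) ∧ (r ∨ (p ∧ u))    ≤⟨ ∧-monotonic (∨-monotonic refl q≤q′)
                                                (∨-monotonic refl (∧-monotonic refl (x≤x∨y u r))) ⟩
      (p ∨ q′) ∧ (r ∨ (p ∧ u′))  ≈⟨ identity₂ p q r u ⟩
      q′ ∨ (p ∧ u′)              ≤⟨ ∨-monotonic q′≤q (∧-monotonic refl (∨-least refl r≤u)) ⟩
      q ∨ (p ∧ u)                ∎)
    where
    q′ u′ : Carrier
    q′ = (p ∨ (q ∧ r)) ∧ r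
    u′ = u ∨ r
    q≤q′ : q ≤ q′
    q≤q′ = ∧-greatest (trans (∧-greatest refl q≤r) (y≤x∨y p _)) q≤r
    q′≤q : q′ ≤ q
    q′≤q = trans (∧-monotonic (∨-monotonic refl (x∧y≤x q r)) refl) [p∨q]∧r≤q

  ∨≈∧-law₂ : ∀ {p q r u} → q ≤ u → u ∧ (p ∨ q) ≤ q → r ≤ p ∨ q → p ∧ (r ∨ u) ≤ r ∨ q →
             r ∨ q ≈ (p ∨ q) ∧ (r ∨ u)
  ∨≈∧-law₂ {p} {q} {r} {u} q≤u u∧[p∨q]≤q r≤p∨q p∧[r∨u]≤r∨q = antisym
    (∨-least (∧-greatest r≤p∨q (x≤x∨y r u)) (∧-greatest (y≤x∨y p q) (trans q≤u (y≤x∨y r u))))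
    (begin
      (p ∨ q) ∧ (r ∨ u)              ≤⟨ ∧-monotonic (∨-monotonic refl q≤q′) (∨-monotonic r≤r′ refl) ⟩
      (p ∨ q′) ∧ (r′ ∨ u)            ≈⟨ identity₃ p q r u ⟩
      (r′ ∨ q′) ∨ (p ∧ (r′ ∨ u))     ≤⟨ ∨-monotonic (∨-monotonic r′≤r q′≤q)
                                                    (∧-monotonic refl (∨-monotonic r′≤r refl)) ⟩
      (r ∨ q) ∨ (p ∧ (r ∨ u))        ≤⟨ ∨-least refl p∧[r∨u]≤r∨q ⟩
      r ∨ q                          ∎)
    where
    q′ r′ : Carrier
    q′ = u ∧ (p ∨ (q ∧ u))
    r′ = r ∧ (p ∨ q′)
    q≤q′ : q ≤ q′
    q≤q′ = ∧-greatest q≤u (trans (∧-greatest refl q≤u) (y≤x∨y p _))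
    q′≤q : q′ ≤ q
    q′≤q = trans (∧-monotonic refl (∨-monotonic refl (x∧y≤x q u))) u∧[p∨q]≤q
    r≤r′ : r ≤ r′
    r≤r′ = ∧-greatest refl (trans r≤p∨q (∨-monotonic refl q≤q′))
    r′≤r : r′ ≤ r
    r′≤r = x∧y≤x r _

≤₂₅-refl : Reflexive _≤₂₅_
≤₂₅-refl = Finₚ.≤-refl , Finₚ.≤-refl

≤₂₅-trans : Transitive _≤₂₅_
≤₂₅-trans (i≤j , k≤l) (j≤m , l≤n) = Finₚ.≤-trans i≤j j≤m , Finₚ.≤-trans k≤l l≤n

≤₂₅-antisym : Antisymmetric _≡_ _≤₂₅_
≤₂₅-antisym (i≤j , k≤l) (j≤i , l≤k) =
  ≡.cong₂ _,_ (Finₚ.≤-antisym i≤j j≤i) (Finₚ.≤-antisym k≤l l≤k)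

_≤₂₅?_ : B.Decidable _≤₂₅_
(i , k) ≤₂₅? (j , l) = (i Finₚ.≤? j) ×-dec (k Finₚ.≤? l)

toℕ² : Fin 2 × Fin 5 → ℕ × ℕ
toℕ² (i , k) = toℕ i , toℕ k

_⊓²_ _⊔²_ : Fin 2 × Fin 5 → Fin 2 × Fin 5 → ℕ × ℕ
(i , k) ⊓² (j , l) = toℕ i ℕ.⊓ toℕ j , toℕ k ℕ.⊓ toℕ l
(i , k) ⊔² (j , l) = toℕ i ℕ.⊔ toℕ j , toℕ k ℕ.⊔ toℕ l

≤₂₅-glb : ∀ {p q r m} → q ⊓² r ≡ toℕ² m → p ≤₂₅ q → p ≤₂₅ r → p ≤₂₅ m
≤₂₅-glb eq (p≤q₁ , p≤q₂) (p≤r₁ , p≤r₂) =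
  ≡.subst (_ ℕ.≤_) (≡.cong proj₁ eq) (ℕₚ.⊓-glb p≤q₁ p≤r₁) ,
  ≡.subst (_ ℕ.≤_) (≡.cong proj₂ eq) (ℕₚ.⊓-glb p≤q₂ p≤r₂)

≤₂₅-lub : ∀ {p q r m} → q ⊔² r ≡ toℕ² m → q ≤₂₅ p → r ≤₂₅ p → m ≤₂₅ p
≤₂₅-lub eq (q≤p₁ , q≤p₂) (r≤p₁ , r≤p₂) =
  ≡.subst (ℕ._≤ _) (≡.cong proj₁ eq) (ℕₚ.⊔-lub q≤p₁ r≤p₁) ,
  ≡.subst (ℕ._≤ _) (≡.cong proj₂ eq) (ℕₚ.⊔-lub q≤p₂ r≤p₂)

grid : Fin 2 × Fin 5 → Lbl
grid (0F , 0F) = w'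
grid (0F , 1F) = w
grid (0F , 2F) = a
grid (0F , 3F) = y
grid (0F , 4F) = y'
grid (1F , 0F) = x'
grid (1F , 1F) = x
grid (1F , 2F) = b
grid (1F , 3F) = z
grid (1F , 4F) = z'

grid-inTen : ∀ q → InTen (grid q)
grid-inTen (0F , 0F) = t-w'
grid-inTen (0F , 1F) = t-w
grid-inTen (0F , 2F) = t-a
grid-inTen (0F , 3F) = t-y
grid-inTen (0F , 4F) = t-y'
grid-inTen (1F , 0F) = t-x'
grid-inTen (1F , 1F) = t-x
grid-inTen (1F , 2F) = t-b
grid-inTen (1F , 3F) = t-z
grid-inTen (1F , 4F) = t-z'

position : Lbl → Fin 2 × Fin 5
position w' = 0F , 0F
position w  = 0F , 1F
position a  = 0F , 2F
position s  = 0F , 2F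
position y  = 0F , 3F
position y' = 0F , 4F
position x' = 1F , 0F
position x  = 1F , 1F
position c  = 0F , 2F
position b  = 1F , 2F
position z  = 1F , 3F
position z' = 1F , 4F

position-grid : ∀ q → position (grid q) ≡ q
position-grid (0F , 0F) = ≡.refl
position-grid (0F , 1F) = ≡.refl
position-grid (0F , 2F) = ≡.refl
position-grid (0F , 3F) = ≡.refl
position-grid (0F , 4F) = ≡.refl
position-grid (1F , 0F) = ≡.refl
position-grid (1F , 1F) = ≡.refl
position-grid (1F , 2F) = ≡.refl
position-grid (1F , 3F) = ≡.refl
position-grid (1F , 4F) = ≡.refl

position-mono : ∀ {i j} → i ⊑ j → position i ≤₂₅ position j
position-mono ε              = ≤₂₅-refl
position-mono (step ◅ steps) = ≤₂₅-trans (cover step) (position-mono steps)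
  where
  cover : ∀ {i j} → Cov i j → position i ≤₂₅ position j
  cover x'x  = ℕₚ.≤-refl , ℕₚ.n≤1+n _
  cover xb   = ℕₚ.≤-refl , ℕₚ.n≤1+n _
  cover bz   = ℕₚ.≤-refl , ℕₚ.n≤1+n _
  cover zz'  = ℕₚ.≤-refl , ℕₚ.n≤1+n _
  cover w'w  = ℕₚ.≤-refl , ℕₚ.n≤1+n _
  cover wa   = ℕₚ.≤-refl , ℕₚ.n≤1+n _
  cover as   = ≤₂₅-refl
  cover sy   = ℕₚ.≤-refl , ℕₚ.n≤1+n _
  cover yy'  = ℕₚ.≤-refl , ℕₚ.n≤1+n _
  cover w'x' = ℕₚ.n≤1+n _ , ℕₚ.≤-refl
  cover wx   = ℕₚ.n≤1+n _ , ℕₚ.≤-refl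
  cover ac   = ≤₂₅-refl
  cover cb   = ℕₚ.n≤1+n _ , ℕₚ.≤-refl
  cover yz   = ℕₚ.n≤1+n _ , ℕₚ.≤-refl
  cover y'z' = ℕₚ.n≤1+n _ , ℕₚ.≤-refl

position-⋢ : ∀ i j {_ : False (position i ≤₂₅? position j)} → ¬ i ⊑ j
position-⋢ i j {i≰j} = toWitnessFalse i≰j ∘ position-mono

module Forbidden {ℓ₀ ℓ₁ ℓ₂} (L : Lattice ℓ₀ ℓ₁ ℓ₂) (inV : InVarietyN L) (conf : Configuration L)
  where
  open Lattice L
  open LawsOf𝒩 L inV

  e : Lbl → Carrier
  e = proj₁ conf

  Generated : Carrier → Set (ℓ₀ ⊔ ℓ₁)
  Generated = GenSub L (λ u → Σ Lbl λ i → InTen i × u ≈ e i)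

  ≤⇔⊑ : ∀ i j → (e i ≤ e j) ⇔ (i ⊑ j)
  ≤⇔⊑ = proj₁ (proj₂ (proj₂ conf))

  isoTo2×5 : IsoTo2×5 L Generated
  isoTo2×5 = proj₂ (proj₂ (proj₂ conf))

  ⊑⇒≤ : ∀ {i j} → i ⊑ j → e i ≤ e j
  ⊑⇒≤ {i} {j} = Equivalence.from (≤⇔⊑ i j)

  ≤⇒⊑ : ∀ {i j} → e i ≤ e j → i ⊑ j
  ≤⇒⊑ {i} {j} = Equivalence.to (≤⇔⊑ i j)

  ⋢⇒≰ : ∀ {i j} → ¬ i ⊑ j → ¬ e i ≤ e j
  ⋢⇒≰ i⋢j = i⋢j ∘ ≤⇒⊑

  grid-generated : ∀ q → Generated (e (grid q))
  grid-generated q = gen (grid q , grid-inTen q , Eq.refl)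

  grid-≤⇒≤₂₅ : ∀ {q r} → e (grid q) ≤ e (grid r) → q ≤₂₅ r
  grid-≤⇒≤₂₅ {q} {r} =
    ≡.subst₂ _≤₂₅_ (position-grid q) (position-grid r) ∘ position-mono ∘ ≤⇒⊑

  grid-injective : ∀ {q r} → e (grid q) ≈ e (grid r) → q ≡ r
  grid-injective eq =
    ≤₂₅-antisym (grid-≤⇒≤₂₅ (reflexive eq)) (grid-≤⇒≤₂₅ (reflexive (Eq.sym eq)))

  generated⇒grid : ∀ {u} → Generated u → ∃ λ q → u ≈ e (grid q)
  generated⇒grid {u} gen-u =
    let j , u≈fj = inImage u gen-u
        q , fj≈gq = injection-into-image-is-onto setoid (↔-sym Finₚ.*↔×) f (e ∘ grid)
                      grid-injective (λ q → inImage _ (grid-generated q)) j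
    in q , Eq.trans u≈fj fj≈gq
    where
    f : Fin 2 × Fin 5 → Carrier
    f = proj₁ isoTo2×5
    inImage : ∀ u → Generated u → ∃ λ q → u ≈ f q
    inImage = proj₁ (proj₂ (proj₂ isoTo2×5))

  meet-of-cells : ∀ q r t → grid t ⊑ grid q → grid t ⊑ grid r → q ⊓² r ≡ toℕ² t →
                  e (grid q) ∧ e (grid r) ≈ e (grid t)
  meet-of-cells q r t t⊑q t⊑r q⊓r≡t =
    pin (generated⇒grid (meet (grid-generated q) (grid-generated r)))
    where
    pin : (∃ λ k → e (grid q) ∧ e (grid r) ≈ e (grid k)) → e (grid q) ∧ e (grid r) ≈ e (grid t)
    pin (k , q∧r≈k) = Eq.trans q∧r≈k (Eq.reflexive (≡.cong (e ∘ grid) (≤₂₅-antisym k≤t t≤k)))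
      where
      k≤t : k ≤₂₅ t
      k≤t = ≤₂₅-glb q⊓r≡t (grid-≤⇒≤₂₅ (trans (reflexive (Eq.sym q∧r≈k)) (x∧y≤x _ _)))
                          (grid-≤⇒≤₂₅ (trans (reflexive (Eq.sym q∧r≈k)) (x∧y≤y _ _)))
      t≤k : t ≤₂₅ k
      t≤k = grid-≤⇒≤₂₅ (trans (∧-greatest (⊑⇒≤ t⊑q) (⊑⇒≤ t⊑r)) (reflexive q∧r≈k))

  join-of-cells : ∀ q r t → grid q ⊑ grid t → grid r ⊑ grid t → q ⊔² r ≡ toℕ² t →
                  e (grid q) ∨ e (grid r) ≈ e (grid t)
  join-of-cells q r t q⊑t r⊑t q⊔r≡t =
    pin (generated⇒grid (join (grid-generated q) (grid-generated r)))
    where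
    pin : (∃ λ k → e (grid q) ∨ e (grid r) ≈ e (grid k)) → e (grid q) ∨ e (grid r) ≈ e (grid t)
    pin (k , q∨r≈k) = Eq.trans q∨r≈k (Eq.reflexive (≡.cong (e ∘ grid) (≤₂₅-antisym k≤t t≤k)))
      where
      k≤t : k ≤₂₅ t
      k≤t = grid-≤⇒≤₂₅ (trans (reflexive (Eq.sym q∨r≈k)) (∨-least (⊑⇒≤ q⊑t) (⊑⇒≤ r⊑t)))
      t≤k : t ≤₂₅ k
      t≤k = ≤₂₅-lub q⊔r≡t (grid-≤⇒≤₂₅ (trans (x≤x∨y _ _) (reflexive q∨r≈k)))
                          (grid-≤⇒≤₂₅ (trans (y≤x∨y _ _) (reflexive q∨r≈k)))

  x∧a≤w : e x ∧ e a ≤ e w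
  x∧a≤w = reflexive (meet-of-cells (1F , 1F) (0F , 2F) (0F , 1F) (wx ◅ ε) (wa ◅ ε) ≡.refl)

  x'∧y'≤w : e x' ∧ e y' ≤ e w
  x'∧y'≤w = trans (reflexive (meet-of-cells (1F , 0F) (0F , 4F) (0F , 0F) (w'x' ◅ ε)
                                             (w'w ◅ wa ◅ as ◅ sy ◅ yy' ◅ ε) ≡.refl))
                  (⊑⇒≤ (w'w ◅ ε))

  y'∧z≤y : e y' ∧ e z ≤ e y
  y'∧z≤y = reflexive (meet-of-cells (0F , 4F) (1F , 3F) (0F , 3F) (yy' ◅ ε) (yz ◅ ε) ≡.refl)

  x'∨y≈z : e x' ∨ e y ≈ e z
  x'∨y≈z = join-of-cells (1F , 0F) (0F , 3F) (1F , 3F) (x'x ◅ xb ◅ bz ◅ ε) (yz ◅ ε) ≡.refl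

  m : Carrier
  m = e x' ∧ e c

  w∨m-doublyReducible : ¬ m ≤ e w → DoublyReducible L (e w ∨ m)
  w∨m-doublyReducible m≰w =
    e w , m , e x' ∨ e w , e a ∨ m , (w≰m , m≰w) , (x'∨w≰a∨m , a∨m≰x'∨w) , Eq.refl ,
    ∨≈∧-law₁ (⊑⇒≤ (wa ◅ ε)) (⊑⇒≤ (ac ◅ ε)) [x'∨w]∧a≤w
    where
    x'∨w≤x : e x' ∨ e w ≤ e x
    x'∨w≤x = ∨-least (⊑⇒≤ (x'x ◅ ε)) (⊑⇒≤ (wx ◅ ε))
    a∨m≤c : e a ∨ m ≤ e c
    a∨m≤c = ∨-least (⊑⇒≤ (ac ◅ ε)) (x∧y≤y _ _)
    [x'∨w]∧a≤w : (e x' ∨ e w) ∧ e a ≤ e w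
    [x'∨w]∧a≤w = trans (∧-greatest (trans (x∧y≤x _ _) x'∨w≤x) (x∧y≤y _ _)) x∧a≤w
    w≰m : ¬ e w ≤ m
    w≰m w≤m = ⋢⇒≰ (position-⋢ w x') (trans w≤m (x∧y≤x _ _))
    x'∨w≰a∨m : ¬ e x' ∨ e w ≤ e a ∨ m
    x'∨w≰a∨m le = ⋢⇒≰ (position-⋢ x' c) (trans (x≤x∨y _ _) (trans le a∨m≤c))
    a∨m≰x'∨w : ¬ e a ∨ m ≤ e x' ∨ e w
    a∨m≰x'∨w le = ⋢⇒≰ (position-⋢ a x) (trans (x≤x∨y _ _) (trans le x'∨w≤x))

  c∨y-doublyReducible : m ≤ e w → DoublyReducible L (e c ∨ e y)
  c∨y-doublyReducible m≤w =
    e c , e y , e x' ∨ e y , e c ∨ e y' , (⋢⇒≰ c⋢y , ⋢⇒≰ (position-⋢ y c)) ,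
    (x'∨y≰c∨y' , c∨y'≰x'∨y) , Eq.refl ,
    ∨≈∧-law₂ (⊑⇒≤ (yy' ◅ ε)) y'∧[x'∨y]≤y c≤x'∨y (trans x'∧[c∨y']≤w w≤c∨y)
    where
    -- position c ≤₂₅ position y, so the step out of c has to be taken first.
    c⋢y : ¬ c ⊑ y
    c⋢y (cb ◅ b⊑y) = position-⋢ b y b⊑y
    c≤x'∨y : e c ≤ e x' ∨ e y
    c≤x'∨y = trans (⊑⇒≤ (cb ◅ bz ◅ ε)) (reflexive (Eq.sym x'∨y≈z))
    y'∧[x'∨y]≤y : e y' ∧ (e x' ∨ e y) ≤ e y
    y'∧[x'∨y]≤y = trans (∧-greatest (x∧y≤x _ _) (trans (x∧y≤y _ _) (reflexive x'∨y≈z))) y'∧z≤y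
    w≤c∨y : e w ≤ e c ∨ e y
    w≤c∨y = trans (⊑⇒≤ (wa ◅ ac ◅ ε)) (x≤x∨y _ _)
    x'∧[c∨y']≤w : e x' ∧ (e c ∨ e y') ≤ e w
    x'∧[c∨y']≤w = trans (∧-distribˡ-∨-absorbed (trans x'∧y'≤w (⊑⇒≤ (wa ◅ ac ◅ ε)))
                                                (trans m≤w (⊑⇒≤ (wa ◅ as ◅ sy ◅ yy' ◅ ε))))
                        (∨-least m≤w x'∧y'≤w)
    x'∨y≰c∨y' : ¬ e x' ∨ e y ≤ e c ∨ e y'
    x'∨y≰c∨y' le =
      ⋢⇒≰ (position-⋢ x' w) (trans (∧-greatest refl (trans (x≤x∨y _ _) le)) x'∧[c∨y']≤w)
    c∨y'≰x'∨y : ¬ e c ∨ e y' ≤ e x' ∨ e y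
    c∨y'≰x'∨y le = ⋢⇒≰ (position-⋢ y' z) (trans (y≤x∨y _ _) (trans le (reflexive x'∨y≈z)))

lemma5p12 : ∀ {c ℓ₁ ℓ₂} (L : Lattice c ℓ₁ ℓ₂) →
    InVarietyN L → NoDoublyReducible L → ¬ Configuration L
lemma5p12 L inV noDR conf =
  noDR _ (w∨m-doublyReducible λ m≤w → noDR _ (c∨y-doublyReducible m≤w))
  where open Forbidden L inV conf
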